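{- Let $t\in\mathbb{N}$ and let $H$ be a graph whose vertex set is the union of three pairwise disjoint sets $A$, $B$, $C$ such that: (1) $A$ and $B$ are independent sets, each of size $3t^2+t$; (2) $A$ is complete to $B$; (3) $|C|\ge 2$ and $H[C]$ is a path with endpoints $x$ and $y$; (4) both $x$ and $y$ have neighbours in $A\cup B$, and $C\setminus\{x,y\}$ is anticomplete to $A\cup B$; (5) $\deg_H(x)=2$; (6) $N(x)\cap(A\cup B)\neq N(y)\cap(A\cup B)$. Then $H\xrightarrow{\cap}tS_{t,t,t}$.
   Context: All graphs are finite and simple. For graphs $G_1=(V_1,E_1)$, $G_2=(V_2,E_2)$, $G_1\cap G_2=(V_1\cap V_2,E_1\cap E_2)$. For $G=(V,E)$ and an injective map $\alpha$ on $V$, $G^{\alpha}$ has vertex set $\alpha(V)$ and edge set $\{\{\alpha(v),\alpha(w)\}:\{v,w\}\in E\}$. We write $G\xrightarrow{\cap}H$ if $H=G^{\alpha_1}\cap\cdots\cap G^{\alpha_k}$ for some injective maps $\alpha_1,\dots,\alpha_k$ on $V(G)$ (up to isomorphism of $H$). $S_{t,t,t}$ is obtained from $K_{1,3}$ by subdividing each edge with $t-1$ new vertices; $tS_{t,t,t}$ is the disjoint union of $t$ copies of $S_{t,t,t}$. Sets $X,Y$ are complete (anticomplete) to each other if every (no) vertex of $X$ is adjacent to every (any) vertex of $Y$. -}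

module Defs where

open import Data.Nat using (ℕ; zero; suc; _+_; _*_)
open import Data.Bool using (Bool; true; false; T; _∧_; _∨_; if_then_else_)
open import Data.Unit using (⊤; tt)
open import Data.Empty using (⊥)
open import Data.Fin using (Fin; zero; suc; toℕ; fromℕ)
import Data.Fin as F
import Data.Nat as N
open import Data.Fin.Subset using (Subset; _∈_; _∉_; _∪_; _∩_; ∁; ∣_∣)
open import Data.Vec using (tabulate)
open import Data.Product using (Σ; ∃; ∃₂; _×_; _,_)
open import Data.Sum using (_⊎_; inj₁; inj₂)
open import Relation.Nullary using (¬_; does)
open import Relation.Binary.PropositionalEquality using (_≡_; _≢_)
open import Function.Definitions using (Injective)
open import Function.Bundles using (_⇔_)

record Graph (V : Set) : Set where
  field
    adj : V → V → Bool
open Graph public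

Edge : ∀ {V} → Graph V → V → V → Set
Edge G u v = T (adj G u v)

IsSimple : ∀ {V} → Graph V → Set
IsSimple G = (∀ u v → adj G u v ≡ adj G v u) × (∀ v → adj G v v ≡ false)

-- Intersection representation  G →∩ H
-- Injective maps α_i : V(G) → ℕ (a common ground set); G^{α_i} is the
-- image graph; the intersection graph has vertex set ⋂ α_i(V) and
-- edge set ⋂ E(G^{α_i}).

module _ {n : ℕ} (G : Graph (Fin n)) {k : ℕ} (α : Fin (suc k) → Fin n → ℕ) where
  InterV : ℕ → Set
  InterV u = ∀ i → ∃ λ v → α i v ≡ u

  InterE : ℕ → ℕ → Set
  InterE u w = ∀ i → ∃₂ λ v v' → α i v ≡ u × α i v' ≡ w × Edge G v v'

IsoToInter : ∀ {n V} → Graph (Fin n) → Graph V → {k : ℕ} → (Fin (suc k) → Fin n → ℕ) → Set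
IsoToInter G H α =
  Σ (_ → ℕ) λ f →
    Injective _≡_ _≡_ f
    × (∀ u → InterV G α u ⇔ (∃ λ a → f a ≡ u))
    × (∀ a b → Edge H a b ⇔ InterE G α (f a) (f b))

_→∩_ : ∀ {n V} → Graph (Fin n) → Graph V → Set
G →∩ H = ∃ λ k → Σ (Fin (suc k) → _ → ℕ) λ α →
  (∀ i → Injective _≡_ _≡_ (α i)) × IsoToInter G H α

-- t S_{t,t,t}: copies indexed by Fin t; in each copy a centre (inj₁ tt)
-- and three legs (Fin 3) of t vertices, (l , d) at distance d+1 from the centre.

SVert : ℕ → Set
SVert t = Fin t × (⊤ ⊎ (Fin 3 × Fin t))

private
  eqF : ∀ {m} → Fin m → Fin m → Bool
  eqF a b = does (a F.≟ b)

  eqN : ℕ → ℕ → Bool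
  eqN a b = does (a N.≟ b)

  legAdj : ∀ {t} → (⊤ ⊎ (Fin 3 × Fin t)) → (⊤ ⊎ (Fin 3 × Fin t)) → Bool
  legAdj (inj₁ _) (inj₁ _) = false
  legAdj (inj₁ _) (inj₂ (l , d)) = eqN (toℕ d) 0
  legAdj (inj₂ (l , d)) (inj₁ _) = eqN (toℕ d) 0
  legAdj (inj₂ (l , d)) (inj₂ (l' , d')) =
    eqF l l' ∧ (eqN (suc (toℕ d)) (toℕ d') ∨ eqN (suc (toℕ d')) (toℕ d))

tSttt : (t : ℕ) → Graph (SVert t)
tSttt t = record { adj = λ { (c , x) (c' , y) → eqF c c' ∧ legAdj x y } }

Independent : ∀ {n} → Graph (Fin n) → Subset n → Set
Independent H A = ∀ u v → u ∈ A → v ∈ A → ¬ Edge H u v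

Complete : ∀ {n} → Graph (Fin n) → Subset n → Subset n → Set
Complete H A B = ∀ u v → u ∈ A → v ∈ B → Edge H u v

Anticomplete : ∀ {n} → Graph (Fin n) → Subset n → Subset n → Set
Anticomplete H A B = ∀ u v → u ∈ A → v ∈ B → ¬ Edge H u v

Nbhd : ∀ {n} → Graph (Fin n) → Fin n → Subset n
Nbhd H v = tabulate (adj H v)

deg : ∀ {n} → Graph (Fin n) → Fin n → ℕ
deg H v = ∣ Nbhd H v ∣

IsPathWithEnds : ∀ {n} → Graph (Fin n) → Subset n → Fin n → Fin n → Set
IsPathWithEnds {n} H C x y = ∃ λ k → Σ (Fin (suc (suc k)) → Fin n) λ p →
    Injective _≡_ _≡_ p
  × (∀ i → p i ∈ C)
  × (∀ v → v ∈ C → ∃ λ i → p i ≡ v)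
  × p zero ≡ x
  × p (fromℕ (suc k)) ≡ y
  × (∀ i j → Edge H (p i) (p j) ⇔ (suc (toℕ i) ≡ toℕ j ⊎ suc (toℕ j) ≡ toℕ i))

-- A family of injective homomorphisms tS_{t,t,t} → H that separates every non-edge of tS_{t,t,t}
-- yields the intersection representation: give every other vertex of H a fresh label, different
-- for two of the maps, so that only the images of tS_{t,t,t} survive the intersection.
-- As tS_{t,t,t} is bipartite with exactly 3t² + t vertices, its colour classes embed bijectively
-- into A and B, which separates all pairs of equal colour. For a leg vertex v, send v to x, the
-- parent of v to the neighbour a of x in A ∪ B, the rest of the leg along the path to y, then to
-- a neighbour z ≠ a of y (given by (6)) and on alternately into A and B; everything else goes
-- into A ∪ B by colour. Since deg x = 2, the only neighbours of x are the images of the two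
-- neighbours of v, so this embedding separates v from all of its non-neighbours.

module Submission where

open import Defs
open import Data.Nat using (ℕ; zero; suc; _+_; _*_; _∸_; _≤_; _<_; z≤n; s≤s)
import Data.Nat.Properties as ℕ
open import Data.Bool using (Bool; true; false; T; not; _xor_)
import Data.Bool.Properties as Bool
open import Data.Unit using (⊤; tt)
open import Data.Fin using (Fin; zero; suc; toℕ; fromℕ; fromℕ<; inject₁; combine)
import Data.Fin.Properties as Fin
open import Data.Fin.Permutation.Components using (transpose; transpose-inverse)
open import Data.Fin.Subset using (Subset; _∈_; _∉_; _∪_; _∩_; ∁; ∣_∣; Empty; Nonempty; _⊆_; _-_; ⁅_⁆)
open import Data.Fin.Subset.Properties
open import Data.Vec using (_∷_; here; there)
import Data.Vec.Properties as Vec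
open import Data.Maybe using (Maybe; just; nothing; maybe)
open import Data.Product using (∃; _×_; _,_; proj₁; proj₂)
open import Data.Sum using (_⊎_; inj₁; inj₂; [_,_]′)
import Data.Sum as Sum
open import Data.Empty using (⊥-elim)
open import Relation.Nullary using (¬_; Dec; yes; no; does; contradiction)
open import Relation.Nullary.Decidable using (T?; ¬?; _×-dec_; dec-true; decidable-stable)
open import Relation.Binary.PropositionalEquality
open import Relation.Binary.Definitions using (tri<; tri≈; tri>)
open import Function using (_∘_)
open import Function.Definitions using (Injective)
open import Function.Bundles using (mk⇔; Equivalence; _↔_; Inverse; Injection)
open import Function.Properties.Inverse using (↔-refl; ↔-sym; ↔-trans; ↔⇒↣)
open import Data.Sum.Function.Propositional using (_⊎-↔_)
open import Data.Product.Function.NonDependent.Propositional using (_×-↔_)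
open import Data.Nat.Tactic.RingSolver using (solve-∀)

module _ {n : ℕ} where

  transpose-matchʳ : ∀ (i j : Fin n) → transpose i j j ≡ i
  transpose-matchʳ i j with j Fin.≟ i
  ... | yes j≡i = j≡i
  ... | no _ with j Fin.≟ j
  ...   | yes _ = refl
  ...   | no j≢j = contradiction refl j≢j

  transpose-other : ∀ {i j k : Fin n} → k ≢ i → k ≢ j → transpose i j k ≡ k
  transpose-other {i} {j} {k} k≢i k≢j with k Fin.≟ i
  ... | yes k≡i = contradiction k≡i k≢i
  ... | no _ with k Fin.≟ j
  ...   | yes k≡j = contradiction k≡j k≢j
  ...   | no _ = refl

  transpose-injective : ∀ (i j : Fin n) → Injective _≡_ _≡_ (transpose i j)
  transpose-injective i j {k} {k′} eq =
    trans (sym (transpose-inverse j i)) (trans (cong (transpose j i) eq) (transpose-inverse j i))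

  transpose-∈ : ∀ {S : Subset n} {i j k : Fin n} → i ∈ S → j ∈ S → k ∈ S → transpose i j k ∈ S
  transpose-∈ {i = i} {j} {k} i∈S j∈S k∈S with k Fin.≟ i
  ... | yes _ = j∈S
  ... | no _ with k Fin.≟ j
  ...   | yes _ = i∈S
  ...   | no _ = k∈S

record Enumeration {n : ℕ} (m : ℕ) (S : Subset n) : Set where
  field
    at : Fin m → Fin n
    injective : Injective _≡_ _≡_ at
    at-∈ : ∀ i → at i ∈ S
open Enumeration

enumerate : ∀ {n} (S : Subset n) → Fin ∣ S ∣ → Fin n
enumerate (true ∷ S) zero = zero
enumerate (true ∷ S) (suc i) = suc (enumerate S i)
enumerate (false ∷ S) i = suc (enumerate S i)

enumerate-injective : ∀ {n} (S : Subset n) → Injective _≡_ _≡_ (enumerate S)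
enumerate-injective (true ∷ S) {zero} {zero} _ = refl
enumerate-injective (true ∷ S) {suc i} {suc j} eq = cong suc (enumerate-injective S (Fin.suc-injective eq))
enumerate-injective (false ∷ S) eq = enumerate-injective S (Fin.suc-injective eq)

enumerate-∈ : ∀ {n} (S : Subset n) i → enumerate S i ∈ S
enumerate-∈ (true ∷ S) zero = here
enumerate-∈ (true ∷ S) (suc i) = there (enumerate-∈ S i)
enumerate-∈ (false ∷ S) i = there (enumerate-∈ S i)

enumeration : ∀ {n m} (S : Subset n) → ∣ S ∣ ≡ m → Enumeration m S
enumeration S refl = record
  { at = enumerate S ; injective = enumerate-injective S ; at-∈ = enumerate-∈ S }

pin : ∀ {n m} {S : Subset n} → Enumeration m S → Fin m → (v : Fin n) → v ∈ S → Enumeration m S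
pin E i v v∈S = record
  { at = λ j → transpose v (at E i) (at E j)
  ; injective = λ eq → injective E (transpose-injective v (at E i) eq)
  ; at-∈ = λ j → transpose-∈ v∈S (at-∈ E i) (at-∈ E j)
  }

module _ {n m} {S : Subset n} (E : Enumeration m S) (i : Fin m) (v : Fin n) (v∈S : v ∈ S) where

  pin-at : at (pin E i v v∈S) i ≡ v
  pin-at = transpose-matchʳ v (at E i)

  pin-other : ∀ {j} → j ≢ i → at E j ≢ v → at (pin E i v v∈S) j ≡ at E j
  pin-other j≢i Ej≢v = transpose-other Ej≢v (λ eq → j≢i (injective E eq))

module _ {n : ℕ} (H : Graph (Fin n)) {v w : Fin n} where

  ∈-Nbhd⁺ : Edge H v w → w ∈ Nbhd H v
  ∈-Nbhd⁺ e = Vec.lookup⇒[]= w (Nbhd H v) (trans (Vec.lookup∘tabulate (adj H v) w) (Bool.T-≡ .Equivalence.to e))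

  ∈-Nbhd⁻ : w ∈ Nbhd H v → Edge H v w
  ∈-Nbhd⁻ w∈ = Bool.T-≡ .Equivalence.from (trans (sym (Vec.lookup∘tabulate (adj H v) w)) (Vec.[]=⇒lookup w∈))

3≤∣p∣ : ∀ {n} {S : Subset n} {u v w} → u ∈ S → v ∈ S → w ∈ S → u ≢ v → u ≢ w → v ≢ w → 3 ≤ ∣ S ∣
3≤∣p∣ {S = S} {u} {v} {w} u∈ v∈ w∈ u≢v u≢w v≢w = begin
  3                      ≤⟨ s≤s (s≤s (s≤s z≤n)) ⟩
  3 + ∣ S - u - v - w ∣  ≤⟨ s≤s (s≤s (x∈p⇒∣p-x∣<∣p∣ w∈S-u-v)) ⟩
  2 + ∣ S - u - v ∣      ≤⟨ s≤s (x∈p⇒∣p-x∣<∣p∣ v∈S-u) ⟩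
  1 + ∣ S - u ∣          ≤⟨ x∈p⇒∣p-x∣<∣p∣ u∈ ⟩
  ∣ S ∣                  ∎
  where
  open ℕ.≤-Reasoning
  v∈S-u = x∈p∧x≢y⇒x∈p-y v∈ (u≢v ∘ sym)
  w∈S-u-v = x∈p∧x≢y⇒x∈p-y (x∈p∧x≢y⇒x∈p-y w∈ (u≢w ∘ sym)) (v≢w ∘ sym)

x∈p⇒∣p∣≢0 : ∀ {n} {S : Subset n} {x} → x ∈ S → ∣ S ∣ ≢ 0
x∈p⇒∣p∣≢0 {S = S} {x} x∈S ∣S∣≡0 = ℕ.n≮0 (subst (∣ S - x ∣ <_) ∣S∣≡0 (x∈p⇒∣p-x∣<∣p∣ x∈S))

deg≡2⇒neighbours : ∀ {n} (H : Graph (Fin n)) {v a b} → deg H v ≡ 2 → Edge H v a → Edge H v b → a ≢ b →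
                   ∀ {w} → Edge H v w → w ≡ a ⊎ w ≡ b
deg≡2⇒neighbours H {v} {a} {b} deg≡2 va vb a≢b {w} vw with w Fin.≟ a | w Fin.≟ b
... | yes w≡a | _ = inj₁ w≡a
... | no _ | yes w≡b = inj₂ w≡b
... | no w≢a | no w≢b = contradiction (subst (3 ≤_) deg≡2 three≤deg) (ℕ.<-irrefl refl)
  where
  three≤deg = 3≤∣p∣ (∈-Nbhd⁺ H va) (∈-Nbhd⁺ H vb) (∈-Nbhd⁺ H vw) a≢b (w≢a ∘ sym) (w≢b ∘ sym)

⊆⁅a,b⁆⇒∩≡⁅a⁆ : ∀ {n} {S U : Subset n} {a b} → a ∈ S → a ∈ U → b ∉ U → (∀ {h} → h ∈ S → h ≡ a ⊎ h ≡ b) →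
               S ∩ U ≡ ⁅ a ⁆
⊆⁅a,b⁆⇒∩≡⁅a⁆ {S = S} {U} {a} a∈S a∈U b∉U S⊆⁅a,b⁆ = ⊆-antisym ∩⊆⁅a⁆ ⁅a⁆⊆∩
  where
  ∩⊆⁅a⁆ : S ∩ U ⊆ ⁅ a ⁆
  ∩⊆⁅a⁆ {h} h∈S∩U with x∈p∩q⁻ S U h∈S∩U
  ... | h∈S , h∈U with S⊆⁅a,b⁆ h∈S
  ...   | inj₁ refl = x∈⁅x⁆ a
  ...   | inj₂ refl = contradiction h∈U b∉U
  ⁅a⁆⊆∩ : ⁅ a ⁆ ⊆ S ∩ U
  ⁅a⁆⊆∩ h∈⁅a⁆ rewrite x∈⁅y⁆⇒x≡y a h∈⁅a⁆ = x∈p∩q⁺ (a∈S , a∈U)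

≢⁅⁆⇒∃≢ : ∀ {n} {S : Subset n} (a : Fin n) → Nonempty S → ⁅ a ⁆ ≢ S → ∃ λ z → z ∈ S × z ≢ a
≢⁅⁆⇒∃≢ {S = S} a (s , s∈S) ⁅a⁆≢S with Fin.any? (λ z → z ∈? S ×-dec ¬? (z Fin.≟ a))
... | yes (z , z∈S , z≢a) = z , z∈S , z≢a
... | no ∄ = contradiction (⊆-antisym ⁅a⁆⊆S S⊆⁅a⁆) ⁅a⁆≢S
  where
  only-a : ∀ {z} → z ∈ S → z ≡ a
  only-a {z} z∈S = decidable-stable (z Fin.≟ a) (λ z≢a → ∄ (z , z∈S , z≢a))
  S⊆⁅a⁆ : S ⊆ ⁅ a ⁆
  S⊆⁅a⁆ z∈S = subst (_∈ ⁅ a ⁆) (sym (only-a z∈S)) (x∈⁅x⁆ a)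
  ⁅a⁆⊆S : ⁅ a ⁆ ⊆ S
  ⁅a⁆⊆S z∈⁅a⁆ = subst (_∈ S) (trans (only-a s∈S) (sym (x∈⁅y⁆⇒x≡y a z∈⁅a⁆))) s∈S

-- Each vertex of F gets the label of its code in Fin m; every other vertex of G gets, under the
-- i-th map, a label m + combine i h, so that distinct maps never share an extra label.
module _ {n m K : ℕ} {V : Set} (G : Graph (Fin n)) (F : Graph V) (code : V ↔ Fin m)
         (M : Fin (suc (suc K)) → V → Fin n)
         (M-injective : ∀ i → Injective _≡_ _≡_ (M i))
         (M-hom : ∀ i {u v} → Edge F u v → Edge G (M i u) (M i v))
         (M-separating : ∀ {u v} → ¬ Edge F u v → ∃ λ i → ¬ Edge G (M i u) (M i v))
         where

  open Inverse code using (to; from; strictlyInverseʳ)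

  private
    label : V → ℕ
    label w = toℕ (to w)

    label-injective : Injective _≡_ _≡_ label
    label-injective = Injection.injective (↔⇒↣ code) ∘ Fin.toℕ-injective

    extra : Fin (suc (suc K)) → Fin n → ℕ
    extra i h = m + toℕ (combine i h)

    label≢extra : ∀ w i h → label w ≢ extra i h
    label≢extra w i h eq = ℕ.<⇒≢ (ℕ.<-≤-trans (Fin.toℕ<n (to w)) (ℕ.m≤m+n m _)) eq

    extra-injective : ∀ i i′ h h′ → extra i h ≡ extra i′ h′ → i ≡ i′ × h ≡ h′
    extra-injective i i′ h h′ eq = Fin.combine-injective _ _ _ _ (Fin.toℕ-injective (ℕ.+-cancelˡ-≡ m _ _ eq))

    preimage? : ∀ i h → Dec (∃ λ w → M i w ≡ h)
    preimage? i h with Fin.any? (λ j → M i (from j) Fin.≟ h)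
    ... | yes (j , eq) = yes (from j , eq)
    ... | no ∄ = no λ (w , eq) → ∄ (to w , trans (cong (M i) (strictlyInverseʳ w)) eq)

    α : Fin (suc (suc K)) → Fin n → ℕ
    α i h with preimage? i h
    ... | yes (w , _) = label w
    ... | no _ = extra i h

    α-view : ∀ i h → (∃ λ w → M i w ≡ h × α i h ≡ label w) ⊎ α i h ≡ extra i h
    α-view i h with preimage? i h
    ... | yes (w , eq) = inj₁ (w , eq , refl)
    ... | no _ = inj₂ refl

    α-M : ∀ i w → α i (M i w) ≡ label w
    α-M i w with preimage? i (M i w)
    ... | yes (w′ , eq) = cong label (M-injective i eq)
    ... | no ∄ = contradiction (w , refl) ∄

    α≡label⇒≡M : ∀ i h w → α i h ≡ label w → h ≡ M i w
    α≡label⇒≡M i h w eq with α-view i h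
    ... | inj₁ (w′ , refl , eq′) = cong (M i) (label-injective (trans (sym eq′) eq))
    ... | inj₂ eq′ = contradiction (trans (sym eq) eq′) (label≢extra w i h)

    α-injective : ∀ i → Injective _≡_ _≡_ (α i)
    α-injective i {h} {h′} eq with α-view i h′
    ... | inj₁ (w , refl , eq′) = α≡label⇒≡M i h w (trans eq eq′)
    ... | inj₂ eq′ with α-view i h
    ...   | inj₁ (w , _ , eq″) = contradiction (trans (sym eq″) (trans eq eq′)) (label≢extra w i h′)
    ...   | inj₂ eq″ = proj₂ (extra-injective i i h h′ (trans (sym eq″) (trans eq eq′)))

    common-label : ∀ u → InterV G α u → ∃ λ w → label w ≡ u
    common-label u common with common zero | common (suc zero)
    ... | h , eq | h′ , eq′ with α-view zero h | α-view (suc zero) h′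
    ...   | inj₁ (w , _ , eq″) | _ = w , trans (sym eq″) eq
    ...   | inj₂ _ | inj₁ (w , _ , eq″) = w , trans (sym eq″) eq′
    ...   | inj₂ e₀ | inj₂ e₁ with extra-injective zero (suc zero) h h′ (trans (sym e₀) (trans eq (trans (sym eq′) e₁)))
    ...     | () , _

    edge-reflected : ∀ u v → InterE G α (label u) (label v) → Edge F u v
    edge-reflected u v common with T? (adj F u v)
    ... | yes uv = uv
    ... | no ¬uv with M-separating ¬uv
    ...   | i , ¬MuMv with common i
    ...     | h , h′ , eq , eq′ , hh′
          rewrite α≡label⇒≡M i h u eq | α≡label⇒≡M i h′ v eq′ = contradiction hh′ ¬MuMv

  separatingEmbeddings⇒→∩ : G →∩ F
  separatingEmbeddings⇒→∩ =
    suc K , α , α-injective , label , label-injective ,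
    (λ u → mk⇔ (common-label u) λ { (w , refl) i → M i w , α-M i w }) ,
    (λ u v → mk⇔ (λ uv i → M i u , M i v , α-M i u , α-M i v , M-hom i uv) (edge-reflected u v))

opaque
  SVert↔Fin : ∀ t → SVert t ↔ Fin (3 * t * t + t)
  SVert↔Fin t = ↔-trans (↔-refl ×-↔ branch) (↔-trans (↔-sym (Fin.*↔× {t})) (Fin-cong (size t)))
    where
    branch : (⊤ ⊎ (Fin 3 × Fin t)) ↔ Fin (1 + 3 * t)
    branch = ↔-sym (↔-trans Fin.+↔⊎ (Fin.1↔⊤ ⊎-↔ Fin.*↔×))
    size : ∀ s → s * (1 + 3 * s) ≡ 3 * s * s + s
    size = solve-∀
    Fin-cong : ∀ {a b} → a ≡ b → Fin a ↔ Fin b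
    Fin-cong refl = ↔-refl

depth : ∀ {t} → SVert t → ℕ
depth (_ , inj₁ _) = 0
depth (_ , inj₂ (_ , e)) = suc (toℕ e)

parity : ℕ → Bool
parity zero = false
parity (suc j) = not (parity j)

colour : ∀ {t} → SVert t → Bool
colour w = parity (depth w)

parent : ∀ {t} → Fin t → Fin 3 → Fin t → SVert t
parent c l zero = c , inj₁ tt
parent c l (suc e) = c , inj₂ (l , inject₁ e)

data Parent {t : ℕ} : SVert t → SVert t → Set where
  parent-of : ∀ c l e → Parent (parent c l e) (c , inj₂ (l , e))

Adjacent : ∀ {t} → SVert t → SVert t → Set
Adjacent w w′ = Parent w w′ ⊎ Parent w′ w

depth-parent : ∀ {t} (c : Fin t) l e → depth (parent c l e) ≡ toℕ e
depth-parent c l zero = refl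
depth-parent c l (suc e) = cong suc (Fin.toℕ-inject₁ e)

colour-Parent : ∀ {t} {w w′ : SVert t} → Parent w w′ → colour w′ ≡ not (colour w)
colour-Parent (parent-of c l e) = cong (not ∘ parity) (sym (depth-parent c l e))

module _ {t : ℕ} where

  open Equivalence using (to; from)

  private
    T-does⁺ : ∀ {A : Set} (a? : Dec A) → A → T (does a?)
    T-does⁺ a? a = from Bool.T-≡ (dec-true a? a)

    T-does⁻ : ∀ {A : Set} (a? : Dec A) → T (does a?) → A
    T-does⁻ (yes a) _ = a

    T-≟ : ∀ {k} (i : Fin k) → T (does (i Fin.≟ i))
    T-≟ i = T-does⁺ (i Fin.≟ i) refl

  Parent⇒Edge : ∀ {w w′ : SVert t} → Parent w w′ → Edge (tSttt t) w w′
  Parent⇒Edge (parent-of c l zero) = from Bool.T-∧ (T-≟ c , _)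
  Parent⇒Edge (parent-of c l (suc e)) = from Bool.T-∧ (T-≟ c ,
    from Bool.T-∧ (T-≟ l , from Bool.T-∨ (inj₁ (T-does⁺ (_ ℕ.≟ _) (cong suc (Fin.toℕ-inject₁ e))))))

  Parent⇒Edge˘ : ∀ {w w′ : SVert t} → Parent w w′ → Edge (tSttt t) w′ w
  Parent⇒Edge˘ (parent-of c l zero) = from Bool.T-∧ (T-≟ c , _)
  Parent⇒Edge˘ (parent-of c l (suc e)) = from Bool.T-∧ (T-≟ c ,
    from Bool.T-∧ (T-≟ l , from Bool.T-∨ (inj₂ (T-does⁺ (_ ℕ.≟ _) (cong suc (Fin.toℕ-inject₁ e))))))

  successor⇒Parent : ∀ c l {e e′ : Fin t} → suc (toℕ e) ≡ toℕ e′ → Parent (c , inj₂ (l , e)) (c , inj₂ (l , e′))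
  successor⇒Parent c l {e} {suc e′} eq
    rewrite Fin.toℕ-injective {i = e} {j = inject₁ e′} (trans (ℕ.suc-injective eq) (sym (Fin.toℕ-inject₁ e′)))
    = parent-of c l (suc e′)

  Edge⇒Adjacent : ∀ (w w′ : SVert t) → Edge (tSttt t) w w′ → Adjacent w w′
  Edge⇒Adjacent (c , x) (c′ , y) E with T-does⁻ (c Fin.≟ c′) (proj₁ (to Bool.T-∧ E))
  ... | refl = legs x y E
    where
    legs : ∀ x y → Edge (tSttt t) (c , x) (c , y) → Adjacent (c , x) (c , y)
    legs (inj₁ _) (inj₂ (l , zero)) _ = inj₁ (parent-of c l zero)
    legs (inj₂ (l , zero)) (inj₁ _) _ = inj₂ (parent-of c l zero)
    legs (inj₂ (l , e)) (inj₂ (l′ , e′)) E′ with to Bool.T-∧ (proj₂ (to (Bool.T-∧ {x = does (c Fin.≟ c)}) E′))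
    ... | l≡l′ , ee′ with T-does⁻ (l Fin.≟ l′) l≡l′ | to Bool.T-∨ ee′
    ...   | refl | inj₁ e⋖e′ = inj₁ (successor⇒Parent c l (T-does⁻ (_ ℕ.≟ _) e⋖e′))
    ...   | refl | inj₂ e′⋖e = inj₂ (successor⇒Parent c l (T-does⁻ (_ ℕ.≟ _) e′⋖e))
    legs (inj₁ _) (inj₁ _) E′ = ⊥-elim (proj₂ (to (Bool.T-∧ {x = does (c Fin.≟ c)}) E′))
    legs (inj₁ _) (inj₂ (_ , suc _)) E′ = ⊥-elim (proj₂ (to (Bool.T-∧ {x = does (c Fin.≟ c)}) E′))
    legs (inj₂ (_ , suc _)) (inj₁ _) E′ = ⊥-elim (proj₂ (to (Bool.T-∧ {x = does (c Fin.≟ c)}) E′))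

  Adjacent⇒Edge : ∀ {w w′ : SVert t} → Adjacent w w′ → Edge (tSttt t) w w′
  Adjacent⇒Edge = [ Parent⇒Edge , Parent⇒Edge˘ ]′

record CompleteBipartite {n : ℕ} (H : Graph (Fin n)) (m : ℕ) (P Q : Subset n) : Set where
  field
    disjoint : ∀ {h} → h ∈ P → h ∉ Q
    P-independent : Independent H P
    Q-independent : Independent H Q
    complete : Complete H P Q
    ∣P∣≡m : ∣ P ∣ ≡ m
    ∣Q∣≡m : ∣ Q ∣ ≡ m

module _ {n : ℕ} {H : Graph (Fin n)} where

  Edge-sym : (∀ u v → adj H u v ≡ adj H v u) → ∀ {u v} → Edge H u v → Edge H v u
  Edge-sym H-sym {u} {v} = subst T (H-sym u v)

  CompleteBipartite-swap : (∀ u v → adj H u v ≡ adj H v u) → ∀ {m P Q} →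
                           CompleteBipartite H m P Q → CompleteBipartite H m Q P
  CompleteBipartite-swap H-sym K = record
    { disjoint = λ h∈Q h∈P → disjoint h∈P h∈Q
    ; P-independent = Q-independent
    ; Q-independent = P-independent
    ; complete = λ u v u∈Q v∈P → Edge-sym H-sym (complete v u v∈P u∈Q)
    ; ∣P∣≡m = ∣Q∣≡m
    ; ∣Q∣≡m = ∣P∣≡m
    }
    where open CompleteBipartite K

module Embeddings
  {t n : ℕ} {H : Graph (Fin n)} (H-sym : ∀ u v → adj H u v ≡ adj H v u)
  {P Q : Subset n} (PQ : CompleteBipartite H (3 * t * t + t) P Q)
  {k : ℕ} (p : Fin (suc (suc k)) → Fin n) (p-injective : Injective _≡_ _≡_ p)
  (p∉P : ∀ i → p i ∉ P) (p∉Q : ∀ i → p i ∉ Q)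
  (p-edge : ∀ i j → suc (toℕ i) ≡ toℕ j → Edge H (p i) (p j))
  {a : Fin n} (a∈P : a ∈ P) (x-a : Edge H (p zero) a)
  (N[x] : ∀ {h} → Edge H (p zero) h → h ≡ a ⊎ h ≡ p (suc zero))
  {z : Fin n} (z∈P⊎Q : z ∈ P ⊎ z ∈ Q) (y-z : Edge H (p (fromℕ (suc k))) z) (z≢a : z ≢ a)
  where

  open CompleteBipartite PQ

  m : ℕ
  m = 3 * t * t + t

  open Inverse (SVert↔Fin t) using () renaming (to to ι; from to ι⁻¹; strictlyInverseʳ to ι⁻¹∘ι)

  ι-injective : Injective _≡_ _≡_ ι
  ι-injective = Injection.injective (↔⇒↣ (SVert↔Fin t))

  side : Bool → Subset n
  side true = P
  side false = Q

  side-complete : ∀ b {u v} → u ∈ side b → v ∈ side (not b) → Edge H u v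
  side-complete true u∈ v∈ = complete _ _ u∈ v∈
  side-complete false u∈ v∈ = Edge-sym H-sym (complete _ _ v∈ u∈)

  side-independent : ∀ b {u v} → u ∈ side b → v ∈ side b → ¬ Edge H u v
  side-independent true = P-independent _ _
  side-independent false = Q-independent _ _

  side-unique : ∀ b b′ {h} → h ∈ side b → h ∈ side b′ → b ≡ b′
  side-unique true true _ _ = refl
  side-unique true false h∈P h∈Q = contradiction h∈Q (disjoint h∈P)
  side-unique false true h∈Q h∈P = contradiction h∈Q (disjoint h∈P)
  side-unique false false _ _ = refl

  p∉side : ∀ b i → p i ∉ side b
  p∉side true = p∉P
  p∉side false = p∉Q

  sideOf : ∀ {h} → h ∈ P ⊎ h ∈ Q → Bool
  sideOf (inj₁ _) = true
  sideOf (inj₂ _) = false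

  ∈sideOf : ∀ {h} (h∈ : h ∈ P ⊎ h ∈ Q) → h ∈ side (sideOf h∈)
  ∈sideOf (inj₁ h∈P) = h∈P
  ∈sideOf (inj₂ h∈Q) = h∈Q

  zs : Bool
  zs = sideOf z∈P⊎Q

  enumeration-side : (b : Bool) → Enumeration m (side b)
  enumeration-side true = enumeration P ∣P∣≡m
  enumeration-side false = enumeration Q ∣Q∣≡m

  Placement : Set
  Placement = Bool ⊎ Fin (suc (suc k))

  module Placed (κ : SVert t → Placement) (E : (b : Bool) → Enumeration m (side b))
                (κ-path-injective : ∀ {w w′ i} → κ w ≡ inj₂ i → κ w′ ≡ inj₂ i → w ≡ w′) where

    φ : SVert t → Fin n
    φ w = [ (λ b → at (E b) (ι w)) , p ]′ (κ w)

    φ-side : ∀ {w b} → κ w ≡ inj₁ b → φ w ≡ at (E b) (ι w)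
    φ-side {w} eq = cong [ (λ b → at (E b) (ι w)) , p ]′ eq

    φ-path : ∀ {w i} → κ w ≡ inj₂ i → φ w ≡ p i
    φ-path {w} eq = cong [ (λ b → at (E b) (ι w)) , p ]′ eq

    φ-injective : Injective _≡_ _≡_ φ
    φ-injective {w} {w′} eq with κ w in κw | κ w′ in κw′
    ... | inj₁ b | inj₁ b′ with side-unique b b′ (at-∈ (E b) (ι w)) (subst (_∈ side b′) (sym eq) (at-∈ (E b′) (ι w′)))
    ...   | refl = ι-injective (injective (E b) eq)
    φ-injective eq | inj₁ b | inj₂ i = contradiction (subst (_∈ side b) eq (at-∈ (E b) _)) (p∉side b i)
    φ-injective eq | inj₂ i | inj₁ b = contradiction (subst (_∈ side b) (sym eq) (at-∈ (E b) _)) (p∉side b i)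
    φ-injective eq | inj₂ i | inj₂ i′ with p-injective eq
    ...   | refl = κ-path-injective κw κw′

    φ≡p⇒κ≡ : ∀ {w i} → φ w ≡ p i → κ w ≡ inj₂ i
    φ≡p⇒κ≡ {w} {i} eq with κ w
    ... | inj₁ b = contradiction (subst (_∈ side b) eq (at-∈ (E b) (ι w))) (p∉side b i)
    ... | inj₂ i′ = cong inj₂ (p-injective eq)

    φ-sides-edge : ∀ {w w′ b} → κ w ≡ inj₁ b → κ w′ ≡ inj₁ (not b) → Edge H (φ w) (φ w′)
    φ-sides-edge {w} {w′} {b} κw κw′ rewrite φ-side κw | φ-side κw′ =
      side-complete b (at-∈ (E b) (ι w)) (at-∈ (E (not b)) (ι w′))

    φ-side-nonedge : ∀ {w w′ b} → κ w ≡ inj₁ b → κ w′ ≡ inj₁ b → ¬ Edge H (φ w) (φ w′)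
    φ-side-nonedge {w} {w′} {b} κw κw′ rewrite φ-side κw | φ-side κw′ =
      side-independent b (at-∈ (E b) (ι w)) (at-∈ (E b) (ι w′))

    φ-path-edge : ∀ {w w′ i j} → κ w ≡ inj₂ i → κ w′ ≡ inj₂ j → suc (toℕ i) ≡ toℕ j → Edge H (φ w) (φ w′)
    φ-path-edge κw κw′ i⋖j rewrite φ-path κw | φ-path κw′ = p-edge _ _ i⋖j

  module Standard = Placed (λ w → inj₁ (colour w)) enumeration-side (λ ())

  Standard-hom : ∀ {w w′} → Parent w w′ → Edge H (Standard.φ w) (Standard.φ w′)
  Standard-hom {w} {w′} w⋖w′ = Standard.φ-sides-edge {w} {w′} refl (cong inj₁ (colour-Parent w⋖w′))

  module LegMap (c : Fin t) (l : Fin 3) (d : Fin t) where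

    v u : SVert t
    v = c , inj₂ (l , d)
    u = parent c l d

    stepsPast : SVert t → Maybe ℕ
    stepsPast (_ , inj₁ _) = nothing
    stepsPast (c′ , inj₂ (l′ , e)) with c′ Fin.≟ c | l′ Fin.≟ l | toℕ d ℕ.≤? toℕ e
    ... | yes _ | yes _ | yes _ = just (toℕ e ∸ toℕ d)
    ... | _ | _ | _ = nothing

    stepsPast⁻ : ∀ w {j} → stepsPast w ≡ just j → ∃ λ e → w ≡ (c , inj₂ (l , e)) × toℕ e ≡ toℕ d + j
    stepsPast⁻ (c′ , inj₂ (l′ , e)) eq with c′ Fin.≟ c | l′ Fin.≟ l | toℕ d ℕ.≤? toℕ e
    stepsPast⁻ (c′ , inj₂ (l′ , e)) refl | yes refl | yes refl | yes d≤e = e , refl , sym (ℕ.m+[n∸m]≡n d≤e)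
    stepsPast⁻ (c′ , inj₂ (l′ , e)) () | yes _ | yes _ | no _
    stepsPast⁻ (c′ , inj₂ (l′ , e)) () | yes _ | no _ | _
    stepsPast⁻ (c′ , inj₂ (l′ , e)) () | no _ | _ | _

    stepsPast⁺ : ∀ e {j} → toℕ e ≡ toℕ d + j → stepsPast (c , inj₂ (l , e)) ≡ just j
    stepsPast⁺ e {j} e≡d+j with c Fin.≟ c | l Fin.≟ l | toℕ d ℕ.≤? toℕ e
    ... | yes _ | yes _ | yes _ = cong just (trans (cong (_∸ toℕ d) e≡d+j) (ℕ.m+n∸m≡n (toℕ d) j))
    ... | yes _ | yes _ | no d≰e = contradiction (subst (toℕ d ≤_) (sym e≡d+j) (ℕ.m≤m+n _ _)) d≰e
    ... | yes _ | no l≢l | _ = contradiction refl l≢l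
    ... | no c≢c | _ | _ = contradiction refl c≢c

    stepsPast-parent : ∀ e {j} → toℕ e ≡ toℕ d + suc j → stepsPast (parent c l e) ≡ just j
    stepsPast-parent (suc e) {j} eq = stepsPast⁺ (inject₁ e)
      (trans (Fin.toℕ-inject₁ e) (ℕ.suc-injective (trans eq (ℕ.+-suc (toℕ d) j))))
    stepsPast-parent zero {j} eq = contradiction (trans eq (ℕ.+-suc (toℕ d) j)) λ ()

    stepsPast-v : stepsPast v ≡ just 0
    stepsPast-v = stepsPast⁺ d (sym (ℕ.+-identityʳ (toℕ d)))

    stepsPast-u : stepsPast u ≡ nothing
    stepsPast-u with stepsPast u in eq
    ... | nothing = refl
    ... | just j with stepsPast⁻ u eq
    ...   | e , u≡ , e≡d+j = ⊥-elim (ℕ.<-irrefl refl depth-u≤)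
      where
      depth-u≤ : suc (toℕ d) ≤ toℕ d
      depth-u≤ = begin
        suc (toℕ d)               ≤⟨ s≤s (ℕ.m≤m+n (toℕ d) j) ⟩
        suc (toℕ d + j)           ≡⟨ cong suc e≡d+j ⟨
        depth (c , inj₂ (l , e))  ≡⟨ cong depth u≡ ⟨
        depth u                   ≡⟨ depth-parent c l d ⟩
        toℕ d                     ∎
        where open ℕ.≤-Reasoning

    stepsPast-child : ∀ c′ l′ e′ {e j} → parent c′ l′ e′ ≡ (c , inj₂ (l , e)) → toℕ e ≡ toℕ d + j →
                      stepsPast (c′ , inj₂ (l′ , e′)) ≡ just (suc j)
    stepsPast-child c′ l′ (suc e′) {j = j} refl eq =
      stepsPast⁺ (suc e′) (trans (cong suc (trans (sym (Fin.toℕ-inject₁ e′)) eq)) (sym (ℕ.+-suc (toℕ d) j)))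

    stepsPast-Parent : ∀ {w w′} → Parent w w′ →
        (stepsPast w ≡ nothing × stepsPast w′ ≡ nothing)
      ⊎ (w ≡ u × w′ ≡ v)
      ⊎ (∃ λ j → stepsPast w ≡ just j × stepsPast w′ ≡ just (suc j))
    stepsPast-Parent (parent-of c′ l′ e′) with stepsPast (parent c′ l′ e′) in eq
    ... | just j with stepsPast⁻ _ eq
    ...   | e , w≡ , e≡d+j = inj₂ (inj₂ (j , refl , stepsPast-child c′ l′ e′ w≡ e≡d+j))
    stepsPast-Parent (parent-of c′ l′ e′) | nothing with stepsPast (c′ , inj₂ (l′ , e′)) in eq′
    ... | nothing = inj₁ (refl , refl)
    ... | just zero with stepsPast⁻ _ eq′
    ...   | e , refl , e≡d+0 rewrite Fin.toℕ-injective (trans e≡d+0 (ℕ.+-identityʳ (toℕ d))) =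
      inj₂ (inj₁ (refl , refl))
    stepsPast-Parent (parent-of c′ l′ e′) | nothing | just (suc j) with stepsPast⁻ _ eq′
    ... | e , refl , e≡d+sj = contradiction (trans (sym eq) (stepsPast-parent e e≡d+sj)) λ ()

    -- Beyond the path the leg alternates between the sides, starting on the side of z.
    tailSide : ℕ → Bool
    tailSide j = (parity j xor parity k) xor zs

    along : ℕ → Placement
    along j with j ℕ.<? suc (suc k)
    ... | yes j< = inj₂ (fromℕ< j<)
    ... | no _ = inj₁ (tailSide j)

    along-< : ∀ {j} (j< : j < suc (suc k)) → along j ≡ inj₂ (fromℕ< j<)
    along-< {j} j< with j ℕ.<? suc (suc k)
    ... | yes _ = refl
    ... | no j≮ = contradiction j< j≮

    along-≥ : ∀ {j} → suc (suc k) ≤ j → along j ≡ inj₁ (tailSide j)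
    along-≥ {j} k<j with j ℕ.<? suc (suc k)
    ... | yes j< = contradiction k<j (ℕ.<⇒≱ j<)
    ... | no _ = refl

    along≡inj₂⇒ : ∀ {j i} → along j ≡ inj₂ i → toℕ i ≡ j
    along≡inj₂⇒ {j} eq with j ℕ.<? suc (suc k)
    along≡inj₂⇒ refl | yes j< = Fin.toℕ-fromℕ< j<

    tailSide-suc : ∀ j → tailSide (suc j) ≡ not (tailSide j)
    tailSide-suc j = begin
      (not (parity j) xor parity k) xor zs ≡⟨ cong (_xor zs) (Bool.not-distribˡ-xor (parity j) (parity k)) ⟨
      not (parity j xor parity k) xor zs   ≡⟨ Bool.not-distribˡ-xor (parity j xor parity k) zs ⟨
      not (tailSide j)                      ∎
      where open ≡-Reasoning

    tailSide-z : tailSide (suc (suc k)) ≡ zs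
    tailSide-z = cong (_xor zs)
      (trans (cong (_xor parity k) (Bool.not-involutive (parity k))) (Bool.xor-same (parity k)))

    κ : SVert t → Placement
    κ w = maybe along (inj₁ (colour w xor colour v)) (stepsPast w)

    κ-nothing : ∀ {w} → stepsPast w ≡ nothing → κ w ≡ inj₁ (colour w xor colour v)
    κ-nothing {w} eq = cong (maybe along (inj₁ (colour w xor colour v))) eq

    κ-just : ∀ {w j} → stepsPast w ≡ just j → κ w ≡ along j
    κ-just {w} eq = cong (maybe along (inj₁ (colour w xor colour v))) eq

    κ≡inj₂⇒ : ∀ {w i} → κ w ≡ inj₂ i → stepsPast w ≡ just (toℕ i)
    κ≡inj₂⇒ {w} eq with stepsPast w
    ... | just j = cong just (sym (along≡inj₂⇒ eq))

    κ-path-injective : ∀ {w w′ i} → κ w ≡ inj₂ i → κ w′ ≡ inj₂ i → w ≡ w′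
    κ-path-injective {w} {w′} κw κw′ with stepsPast⁻ w (κ≡inj₂⇒ {w} κw) | stepsPast⁻ w′ (κ≡inj₂⇒ {w′} κw′)
    ... | e , refl , e≡ | e′ , refl , e′≡ = cong (λ e → c , inj₂ (l , e)) (Fin.toℕ-injective (trans e≡ (sym e′≡)))

    κ-u : κ u ≡ inj₁ true
    κ-u = trans (κ-nothing {u} stepsPast-u)
      (cong inj₁ (trans (cong (colour u xor_) (colour-Parent (parent-of c l d))) (Bool.xor-inverseʳ (colour u))))

    κ-v : κ v ≡ inj₂ zero
    κ-v = trans (κ-just stepsPast-v) (along-< (s≤s z≤n))

    -- Without a vertex k + 2 steps past v the pin for z is harmless: no vertex is placed at ι v.
    zIndex : Fin m
    zIndex with toℕ d + suc (suc k) ℕ.<? t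
    ... | yes lt = ι (c , inj₂ (l , fromℕ< lt))
    ... | no _ = ι v

    zIndex-at : ∀ e → toℕ e ≡ toℕ d + suc (suc k) → zIndex ≡ ι (c , inj₂ (l , e))
    zIndex-at e eq with toℕ d + suc (suc k) ℕ.<? t
    ... | yes lt = cong (λ e → ι (c , inj₂ (l , e))) (Fin.toℕ-injective (trans (Fin.toℕ-fromℕ< lt) (sym eq)))
    ... | no ≮t = contradiction (subst (_< t) eq (Fin.toℕ<n e)) ≮t

    u≢ : ∀ {w j} → stepsPast w ≡ just j → u ≢ w
    u≢ eq refl with () ← trans (sym stepsPast-u) eq

    ιu≢zIndex : ι u ≢ zIndex
    ιu≢zIndex eq with toℕ d + suc (suc k) ℕ.<? t
    ... | yes lt = u≢ (stepsPast⁺ _ (Fin.toℕ-fromℕ< lt)) (ι-injective eq)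
    ... | no _ = u≢ stepsPast-v (ι-injective eq)

    pin-a : (b : Bool) → Enumeration m (side b)
    pin-a true = pin (enumeration-side true) (ι u) a a∈P
    pin-a false = enumeration-side false

    z∈side : ∀ {b} → b ≡ zs → z ∈ side b
    z∈side refl = ∈sideOf z∈P⊎Q

    E : (b : Bool) → Enumeration m (side b)
    E b with b Bool.≟ zs
    ... | yes b≡zs = pin (pin-a b) zIndex z (z∈side b≡zs)
    ... | no _ = pin-a b

    E-a : at (E true) (ι u) ≡ a
    E-a with true Bool.≟ zs
    ... | yes true≡zs =
      trans (pin-other (pin-a true) zIndex z (z∈side true≡zs) ιu≢zIndex (λ eq → z≢a (trans (sym eq) a-at))) a-at
      where a-at = pin-at (enumeration-side true) (ι u) a a∈P
    ... | no _ = pin-at (enumeration-side true) (ι u) a a∈P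

    E-z : at (E zs) zIndex ≡ z
    E-z with zs Bool.≟ zs
    ... | yes zs≡zs = pin-at (pin-a zs) zIndex z (z∈side zs≡zs)
    ... | no zs≢zs = contradiction refl zs≢zs

    open Placed κ E κ-path-injective public

    φ-u : φ u ≡ a
    φ-u = trans (φ-side {u} κ-u) E-a

    φ-v : φ v ≡ p zero
    φ-v = φ-path {v} κ-v

    along-edge : ∀ {w w′ j} → stepsPast w ≡ just j → stepsPast w′ ≡ just (suc j) → Edge H (φ w) (φ w′)
    along-edge {w} {w′} {j} sw sw′ with ℕ.<-cmp j (suc k)
    ... | tri< j<k _ _ = φ-path-edge {w} {w′}
      (trans (κ-just {w} sw) (along-< j<2+k)) (trans (κ-just {w′} sw′) (along-< (s≤s j<k)))
      (trans (cong suc (Fin.toℕ-fromℕ< j<2+k)) (sym (Fin.toℕ-fromℕ< (s≤s j<k))))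
      where j<2+k = ℕ.m<n⇒m<1+n j<k
    ... | tri≈ _ refl _ = subst₂ (Edge H) (sym φw≡y) (sym φw′≡z) y-z
      where
      φw≡y : φ w ≡ p (fromℕ (suc k))
      φw≡y = trans (φ-path {w} (trans (κ-just {w} sw) (along-< (ℕ.n<1+n (suc k)))))
                   (cong p (Fin.toℕ-injective (trans (Fin.toℕ-fromℕ< (ℕ.n<1+n (suc k))) (sym (Fin.toℕ-fromℕ (suc k))))))
      φw′≡z : φ w′ ≡ z
      φw′≡z with stepsPast⁻ w′ sw′
      ... | e , refl , e≡ = begin
        φ w′               ≡⟨ φ-side {w′} (trans (κ-just {w′} sw′) (trans (along-≥ ℕ.≤-refl) (cong inj₁ tailSide-z))) ⟩
        at (E zs) (ι w′)   ≡⟨ cong (at (E zs)) (zIndex-at e e≡) ⟨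
        at (E zs) zIndex   ≡⟨ E-z ⟩
        z                  ∎
        where open ≡-Reasoning
    ... | tri> _ _ k<j = φ-sides-edge {w} {w′}
      (trans (κ-just {w} sw) (along-≥ k<j))
      (trans (κ-just {w′} sw′) (trans (along-≥ (ℕ.m≤n⇒m≤1+n k<j)) (cong inj₁ (tailSide-suc j))))

    hom : ∀ {w w′} → Parent w w′ → Edge H (φ w) (φ w′)
    hom {w} {w′} w⋖w′ with stepsPast-Parent w⋖w′
    ... | inj₁ (sw , sw′) =
      φ-sides-edge {w} {w′} (κ-nothing {w} sw) (trans (κ-nothing {w′} sw′) (cong inj₁ flipped))
      where
      flipped : colour w′ xor colour v ≡ not (colour w xor colour v)
      flipped = trans (cong (_xor colour v) (colour-Parent w⋖w′)) (sym (Bool.not-distribˡ-xor (colour w) (colour v)))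
    ... | inj₂ (inj₁ (refl , refl)) = subst₂ (Edge H) (sym φ-u) (sym φ-v) (Edge-sym H-sym x-a)
    ... | inj₂ (inj₂ (j , sw , sw′)) = along-edge {w} {w′} sw sw′

    separating : ∀ {w} → ¬ Adjacent v w → ¬ Edge H (φ v) (φ w)
    separating {w} ¬v~w vw with N[x] (subst (λ h → Edge H h (φ w)) φ-v vw)
    ... | inj₁ φw≡a with φ-injective {w} {u} (trans φw≡a (sym φ-u))
    ...   | refl = ¬v~w (inj₂ (parent-of c l d))
    separating {w} ¬v~w vw | inj₂ φw≡p₁ with stepsPast⁻ w (κ≡inj₂⇒ {w} (φ≡p⇒κ≡ {w} φw≡p₁))
    ... | e , refl , e≡d+1 = ¬v~w (inj₁ (successor⇒Parent c l (sym (trans e≡d+1 (ℕ.+-comm (toℕ d) 1)))))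

  embedding : SVert t → SVert t → Fin n
  embedding (c , inj₁ _) = Standard.φ
  embedding (c , inj₂ (l , d)) = LegMap.φ c l d

  family : Fin (suc m) → SVert t → Fin n
  family zero = Standard.φ
  family (suc i) = embedding (ι⁻¹ i)

  family-injective : ∀ i → Injective _≡_ _≡_ (family i)
  family-injective zero = Standard.φ-injective
  family-injective (suc i) with ι⁻¹ i
  ... | c , inj₁ _ = Standard.φ-injective
  ... | c , inj₂ (l , d) = LegMap.φ-injective c l d

  family-Parent-hom : ∀ i {w w′} → Parent w w′ → Edge H (family i w) (family i w′)
  family-Parent-hom zero = Standard-hom
  family-Parent-hom (suc i) with ι⁻¹ i
  ... | c , inj₁ _ = Standard-hom
  ... | c , inj₂ (l , d) = LegMap.hom c l d

  family-hom : ∀ i {w w′} → Edge (tSttt t) w w′ → Edge H (family i w) (family i w′)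
  family-hom i {w} {w′} ww′ with Edge⇒Adjacent w w′ ww′
  ... | inj₁ w⋖w′ = family-Parent-hom i w⋖w′
  ... | inj₂ w′⋖w = Edge-sym H-sym (family-Parent-hom i w′⋖w)

  leg-separating : ∀ c l d {w′} → ¬ Adjacent (c , inj₂ (l , d)) w′ →
                   ∃ λ i → ¬ Edge H (family i (c , inj₂ (l , d))) (family i w′)
  leg-separating c l d {w′} ¬adj = suc (ι v) ,
    subst (λ x → ¬ Edge H (embedding x v) (embedding x w′)) (sym (ι⁻¹∘ι v)) (LegMap.separating c l d ¬adj)
    where v = c , inj₂ (l , d)

  family-separating : ∀ {w w′} → ¬ Edge (tSttt t) w w′ → ∃ λ i → ¬ Edge H (family i w) (family i w′)
  family-separating {c , inj₂ (l , d)} ¬ww′ = leg-separating c l d (¬ww′ ∘ Adjacent⇒Edge)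
  family-separating {c , inj₁ _} {c′ , inj₂ (l , d)} ¬ww′ with leg-separating c′ l d (¬ww′ ∘ Adjacent⇒Edge ∘ Sum.swap)
  ... | i , ¬E = i , ¬E ∘ Edge-sym H-sym
  family-separating {c , inj₁ _} {c′ , inj₁ _} _ = zero , Standard.φ-side-nonedge {c , inj₁ tt} {c′ , inj₁ tt} refl refl

representation :
  ∀ {t n} {H : Graph (Fin n)} → (∀ u v → adj H u v ≡ adj H v u) →
  ∀ {P Q} → CompleteBipartite H (3 * suc t * suc t + suc t) P Q →
  ∀ {k} (p : Fin (suc (suc k)) → Fin n) → Injective _≡_ _≡_ p → (∀ i → p i ∉ P) → (∀ i → p i ∉ Q) →
  (∀ i j → suc (toℕ i) ≡ toℕ j → Edge H (p i) (p j)) →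
  ∀ {a} → a ∈ P → Edge H (p zero) a → (∀ {h} → Edge H (p zero) h → h ≡ a ⊎ h ≡ p (suc zero)) →
  ∀ {z} → z ∈ P ⊎ z ∈ Q → Edge H (p (fromℕ (suc k))) z → z ≢ a →
  H →∩ tSttt (suc t)
representation {t} {H = H} H-sym PQ p p-injective p∉P p∉Q p-edge a∈P x-a N[x] z∈P⊎Q y-z z≢a =
  separatingEmbeddings⇒→∩ H (tSttt (suc t)) (SVert↔Fin (suc t)) family family-injective family-hom family-separating
  where open Embeddings {suc t} H-sym PQ p p-injective p∉P p∉Q p-edge a∈P x-a N[x] z∈P⊎Q y-z z≢a

lemma5 : (t n : ℕ) (H : Graph (Fin n)) → IsSimple H
    → (A B : Subset n) (x y : Fin n)
    → Empty (A ∩ B)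
    → Independent H A → Independent H B
    → ∣ A ∣ ≡ 3 * t * t + t → ∣ B ∣ ≡ 3 * t * t + t
    → Complete H A B
    → IsPathWithEnds H (∁ (A ∪ B)) x y
    → (∃ λ v → v ∈ (A ∪ B) × Edge H x v)
    → (∃ λ v → v ∈ (A ∪ B) × Edge H y v)
    → (∀ c → c ∈ ∁ (A ∪ B) → c ≢ x → c ≢ y → ∀ v → v ∈ (A ∪ B) → ¬ Edge H c v)
    → deg H x ≡ 2
    → Nbhd H x ∩ (A ∪ B) ≢ Nbhd H y ∩ (A ∪ B)
    → H →∩ tSttt t
lemma5 zero n H _ A B x y _ _ _ ∣A∣≡0 ∣B∣≡0 _ _ (a , a∈A∪B , _) _ _ _ _ with x∈p∪q⁻ A B a∈A∪B
... | inj₁ a∈A = contradiction ∣A∣≡0 (x∈p⇒∣p∣≢0 a∈A)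
... | inj₂ a∈B = contradiction ∣B∣≡0 (x∈p⇒∣p∣≢0 a∈B)
lemma5 (suc t) n H (H-sym , _) A B x y A∩B A-indep B-indep ∣A∣ ∣B∣ A-B
       (k , p , p-injective , p∈C , _ , refl , refl , p-path) (a , a∈U , x-a) (b , b∈U , y-b) _ deg≡2 N[x]∩U≢N[y]∩U =
  let _ , z∈N[y]∩U , z≢a = ≢⁅⁆⇒∃≢ a (b , x∈p∩q⁺ (∈-Nbhd⁺ H y-b , b∈U)) (N[x]∩U≢N[y]∩U ∘ trans N[x]∩U≡⁅a⁆)
  in  represent (x∈p∩q⁻ _ _ z∈N[y]∩U) z≢a (x∈p∪q⁻ A B a∈U)
  where
  AB : CompleteBipartite H (3 * suc t * suc t + suc t) A B
  AB = record { disjoint = λ h∈A h∈B → A∩B (_ , x∈p∩q⁺ (h∈A , h∈B)) ; P-independent = A-indep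
              ; Q-independent = B-indep ; complete = A-B ; ∣P∣≡m = ∣A∣ ; ∣Q∣≡m = ∣B∣ }
  p∉U : ∀ i → p i ∉ A ∪ B
  p∉U i = x∈∁p⇒x∉p (p∈C i)
  p∉A : ∀ i → p i ∉ A
  p∉A i = p∉U i ∘ x∈p∪q⁺ ∘ inj₁
  p∉B : ∀ i → p i ∉ B
  p∉B i = p∉U i ∘ x∈p∪q⁺ ∘ inj₂
  p-edge : ∀ i j → suc (toℕ i) ≡ toℕ j → Edge H (p i) (p j)
  p-edge i j i⋖j = Equivalence.from (p-path i j) (inj₁ i⋖j)
  N[x] : ∀ {h} → Edge H (p zero) h → h ≡ a ⊎ h ≡ p (suc zero)
  N[x] = deg≡2⇒neighbours H deg≡2 x-a (p-edge zero (suc zero) refl) λ { refl → p∉U (suc zero) a∈U }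
  N[x]∩U≡⁅a⁆ : Nbhd H (p zero) ∩ (A ∪ B) ≡ ⁅ a ⁆
  N[x]∩U≡⁅a⁆ = ⊆⁅a,b⁆⇒∩≡⁅a⁆ (∈-Nbhd⁺ H x-a) a∈U (p∉U (suc zero)) (N[x] ∘ ∈-Nbhd⁻ H)
  represent : ∀ {z} → z ∈ Nbhd H (p (fromℕ (suc k))) × z ∈ A ∪ B → z ≢ a → a ∈ A ⊎ a ∈ B → H →∩ tSttt (suc t)
  represent (z∈N[y] , z∈U) z≢a (inj₁ a∈A) =
    representation H-sym AB p p-injective p∉A p∉B p-edge a∈A x-a N[x]
      (x∈p∪q⁻ A B z∈U) (∈-Nbhd⁻ H z∈N[y]) z≢a
  represent (z∈N[y] , z∈U) z≢a (inj₂ a∈B) =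
    representation H-sym (CompleteBipartite-swap H-sym AB) p p-injective p∉B p∉A p-edge a∈B x-a N[x]
      (Sum.swap (x∈p∪q⁻ A B z∈U)) (∈-Nbhd⁻ H z∈N[y]) z≢a
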